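{- Let $G\in\mathcal{G}(n)$ and let $M$ be a positive integer. Let $L'\subset L$ be a set of $L$-vertices of $G$ with $|L'|=8M^{1.5}$ such that the vertices of $L'$ belong to the trees of at most $4M$ distinct $R$-vertices. Then the set $R'$ of all $R$-vertices that are predecessors of at least one vertex of $L'$ satisfies $|R'|\ge 4M$.
   Context: For a positive integer $n$, the family $\mathcal{G}(n)$ consists of all CDAGs (computational DAGs) built as follows. There are $R$-vertices $v_{i,j}$ for all $1\le i\le j\le n$; the vertices $v_{i,i}$ are the input vertices. For every pair $i<j$ the CDAG contains a directed binary tree with exactly $j-i$ leaves, all of whose edges are directed towards its root $v_{i,j}$; the shape of each tree is arbitrary and the trees for distinct pairs are vertex-disjoint. The leaves of the tree rooted at $v_{i,j}$ are the $L$-vertices belonging to $v_{i,j}$; for $k\in\{0,\dots,j-i-1\}$ the $k$-th leaf has exactly two predecessors, $v_{i,i+k}$ and $v_{i+k+1,j}$. $L$ denotes the set of all $L$-vertices of $G$. -}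

module Defs where

open import Data.Nat using (ℕ; _+_; _∸_; _≤_; _<_)
import Data.Nat.Properties as ℕP
open import Data.Product using (_×_; _,_)
open import Data.Product.Properties using (≡-dec)
open import Data.List using (List; map; concatMap; deduplicate; _∷_; [])
open import Relation.Binary.Definitions using (DecidableEquality)

-- An R-vertex v_{i,j} is represented by the pair (i , j).
RVertex : Set
RVertex = ℕ × ℕ

-- An L-vertex is represented by the triple (i , j , k): it is the k-th leaf
-- of the tree rooted at v_{i,j}.  (Tree shapes are irrelevant: the set of
-- L-vertices and their predecessors do not depend on them.)
LVertex : Set
LVertex = ℕ × ℕ × ℕ

IsLVertex : ℕ → LVertex → Set
IsLVertex n (i , j , k) = (1 ≤ i) × (i < j) × (j ≤ n) × (k < j ∸ i)

root : LVertex → RVertex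
root (i , j , k) = (i , j)

preds : LVertex → List RVertex
preds (i , j , k) = (i , i + k) ∷ (i + k + 1 , j) ∷ []

_≟R_ : DecidableEquality RVertex
_≟R_ = ≡-dec ℕP._≟_ ℕP._≟_

roots : List LVertex → List RVertex
roots L' = deduplicate _≟R_ (map root L')

predSet : List LVertex → List RVertex
predSet L' = deduplicate _≟R_ (concatMap preds L')

{-# OPTIONS --safe #-}
-- Group the leaves of L' by the tree they belong to; a tree holding h leaves of L' contributes
-- h² ordered pairs of leaves.  The pair (a , b) is recovered from the two R-vertices
-- (left predecessor of a , right predecessor of b): these determine the root and then the
-- two leaves.  Hence Σ h² ≤ |R'|², while Cauchy–Schwarz gives |L'|² = (Σ h)² ≤ 4M · Σ h².
-- With |L'|² = 64 M³ = (4M)³ this yields (4M)² ≤ |R'|².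
module Submission where

open import Defs
open import Data.Nat using (ℕ; _*_; _^_; _≤_; _≥_; NonZero)
open import Data.List using (List; length)
open import Data.List.Relation.Unary.All using (All)
open import Data.List.Relation.Unary.Unique.Propositional using (Unique)
open import Relation.Binary.PropositionalEquality using (_≡_)

open import Data.Nat using (zero; suc; _+_; z≤n; s≤s)
open import Data.Nat.Properties
open import Data.Nat.ListAction using (sum)
open import Data.Nat.Tactic.RingSolver using (solve-∀)
open import Data.Product using (_×_; _,_; proj₁; proj₂)
open import Data.Sum using (inj₁; inj₂; [_,_]′)
open import Data.Empty using (⊥; ⊥-elim)
open import Function using (_∘_)
open import Data.List using ([]; _∷_; map; filter; _++_; cartesianProduct)
open import Data.List.Properties using (length-++; length-map; length-removeAt′; filter-accept; filter-reject)
open import Data.List.Relation.Unary.Any using (here; there; index; _─_)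
import Data.List.Relation.Unary.All as All
open import Data.List.Relation.Unary.AllPairs using ([]; _∷_)
open import Data.List.Membership.Propositional using (_∈_; _∉_)
open import Data.List.Membership.Propositional.Properties
  using (∈-++⁻; ∈-map⁺; ∈-filter⁻; ∈-concat⁺′; ∈-cartesianProduct⁺; ∈-cartesianProduct⁻; ∈-deduplicate⁺)
open import Data.List.Relation.Unary.Unique.Propositional.Properties using (++⁺; cartesianProduct⁺; filter⁺)
open import Data.List.Relation.Unary.Unique.DecPropositional.Properties _≟R_ using (deduplicate-!)
open import Relation.Binary.Definitions using (DecidableEquality)
open import Relation.Binary.PropositionalEquality using (refl; sym; trans; cong; cong₂; subst₂; _≢_; module ≡-Reasoning)

∈-─⁺ : {A : Set} {x y : A} {ys : List A} (y∈ys : y ∈ ys) → x ∈ ys → x ≢ y → x ∈ (ys ─ y∈ys)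
∈-─⁺ (here refl) (here refl) x≢y = ⊥-elim (x≢y refl)
∈-─⁺ (here refl) (there x∈ys) _ = x∈ys
∈-─⁺ (there _) (here refl) _ = here refl
∈-─⁺ (there y∈ys) (there x∈ys) x≢y = there (∈-─⁺ y∈ys x∈ys x≢y)

length-≤-injectiveOn : {A B : Set} (f : A → B) {xs : List A} {ys : List B} → Unique xs →
  (∀ {x x′} → x ∈ xs → x′ ∈ xs → f x ≡ f x′ → x ≡ x′) →
  (∀ {x} → x ∈ xs → f x ∈ ys) →
  length xs ≤ length ys
length-≤-injectiveOn f {[]} _ _ _ = z≤n
length-≤-injectiveOn f {x ∷ xs} {ys} (x∉xs ∷ unique-xs) injective into = begin
  suc (length xs)           ≤⟨ s≤s (length-≤-injectiveOn f unique-xs (λ p q → injective (there p) (there q)) into′) ⟩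
  suc (length (ys ─ fx∈ys)) ≡⟨ length-removeAt′ ys (index fx∈ys) ⟨
  length ys                 ∎
  where
  open ≤-Reasoning
  fx∈ys : f x ∈ ys
  fx∈ys = into (here refl)
  into′ : ∀ {x′} → x′ ∈ xs → f x′ ∈ (ys ─ fx∈ys)
  into′ x′∈xs = ∈-─⁺ fx∈ys (into (there x′∈xs))
    (λ fx′≡fx → All.lookup x∉xs x′∈xs (sym (injective (there x′∈xs) (here refl) fx′≡fx)))

length-cartesianProduct : {A B : Set} (xs : List A) (ys : List B) →
  length (cartesianProduct xs ys) ≡ length xs * length ys
length-cartesianProduct [] ys = refl
length-cartesianProduct (x ∷ xs) ys = begin
  length (map (x ,_) ys ++ cartesianProduct xs ys)         ≡⟨ length-++ (map (x ,_) ys) ⟩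
  length (map (x ,_) ys) + length (cartesianProduct xs ys) ≡⟨ cong₂ _+_ (length-map (x ,_) ys) (length-cartesianProduct xs ys) ⟩
  length ys + length xs * length ys                        ∎
  where open ≡-Reasoning

square : ℕ → ℕ
square n = n * n

2*m*n≤m*m+n*n : ∀ m n → 2 * m * n ≤ m * m + n * n
2*m*n≤m*m+n*n m n = [ ordered , swapped ]′ (≤-total m n)
  where
  ordered : ∀ {m n} → m ≤ n → 2 * m * n ≤ m * m + n * n
  ordered {m} m≤n with d , refl ← m≤n⇒∃[o]m+o≡n m≤n =
    ≤-trans (m≤m+n _ (d * d)) (≤-reflexive (expand m d))
    where
    expand : ∀ m d → 2 * m * (m + d) + d * d ≡ m * m + (m + d) * (m + d)
    expand = solve-∀
  swapped : n ≤ m → 2 * m * n ≤ m * m + n * n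
  swapped n≤m = subst₂ _≤_ (swap n m) (+-comm (n * n) (m * m)) (ordered n≤m)
    where
    swap : ∀ n m → 2 * n * m ≡ 2 * m * n
    swap = solve-∀

2*m*sum≤sum-squares+length*m*m : ∀ m ns → 2 * m * sum ns ≤ sum (map square ns) + length ns * (m * m)
2*m*sum≤sum-squares+length*m*m m [] = ≤-reflexive (*-zeroʳ (2 * m))
2*m*sum≤sum-squares+length*m*m m (n ∷ ns) = begin
  2 * m * (n + sum ns)                                    ≡⟨ *-distribˡ-+ (2 * m) n (sum ns) ⟩
  2 * m * n + 2 * m * sum ns                              ≤⟨ +-mono-≤ (2*m*n≤m*m+n*n m n) (2*m*sum≤sum-squares+length*m*m m ns) ⟩
  m * m + n * n + (sum (map square ns) + length ns * (m * m)) ≡⟨ regroup (m * m) (n * n) (sum (map square ns)) (length ns * (m * m)) ⟩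
  n * n + sum (map square ns) + (m * m + length ns * (m * m)) ∎
  where
  open ≤-Reasoning
  regroup : ∀ a b q r → a + b + (q + r) ≡ b + q + (a + r)
  regroup = solve-∀

sum*sum≤length*sum-squares : ∀ ns → sum ns * sum ns ≤ length ns * sum (map square ns)
sum*sum≤length*sum-squares [] = z≤n
sum*sum≤length*sum-squares (m ∷ ns) = begin
  (m + s) * (m + s)                   ≡⟨ expand m s ⟩
  m * m + 2 * m * s + s * s           ≤⟨ +-mono-≤ (+-monoʳ-≤ (m * m) (2*m*sum≤sum-squares+length*m*m m ns))
                                                  (sum*sum≤length*sum-squares ns) ⟩
  m * m + (q + r * (m * m)) + r * q   ≡⟨ regroup m q r ⟩
  (1 + r) * (m * m + q)               ∎
  where
  open ≤-Reasoning
  s q r : ℕ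
  s = sum ns
  q = sum (map square ns)
  r = length ns
  expand : ∀ m s → (m + s) * (m + s) ≡ m * m + 2 * m * s + s * s
  expand = solve-∀
  regroup : ∀ m q r → m * m + (q + r * (m * m)) + r * q ≡ (1 + r) * (m * m + q)
  regroup = solve-∀

module Fibres {A B : Set} (_≟_ : DecidableEquality B) (f : A → B) where

  fibre : B → List A → List A
  fibre y = filter (λ x → f x ≟ y)

  fibreSizes : List B → List A → List ℕ
  fibreSizes ys xs = map (λ y → length (fibre y xs)) ys

  private
    sum-fibreSizes-[] : ∀ ys → sum (fibreSizes ys []) ≡ 0
    sum-fibreSizes-[] [] = refl
    sum-fibreSizes-[] (_ ∷ ys) = sum-fibreSizes-[] ys

    sum-fibreSizes-∷-∉ : ∀ {x} xs ys → f x ∉ ys → sum (fibreSizes ys (x ∷ xs)) ≡ sum (fibreSizes ys xs)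
    sum-fibreSizes-∷-∉ xs [] _ = refl
    sum-fibreSizes-∷-∉ xs (y ∷ ys) fx∉ =
      cong₂ _+_ (cong length (filter-reject (λ x → f x ≟ y) (fx∉ ∘ here)))
                (sum-fibreSizes-∷-∉ xs ys (fx∉ ∘ there))

    sum-fibreSizes-∷-∈ : ∀ {x} xs {ys} → Unique ys → f x ∈ ys →
      sum (fibreSizes ys (x ∷ xs)) ≡ suc (sum (fibreSizes ys xs))
    sum-fibreSizes-∷-∈ xs {y ∷ ys} (y∉ys ∷ _) (here fx≡y) =
      cong₂ _+_ (cong length (filter-accept (λ x → f x ≟ y) fx≡y))
                (sum-fibreSizes-∷-∉ xs ys (λ fx∈ys → All.lookup y∉ys fx∈ys (sym fx≡y)))
    sum-fibreSizes-∷-∈ xs {y ∷ ys} (y∉ys ∷ unique-ys) (there fx∈ys) =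
      trans (cong₂ _+_ (cong length (filter-reject (λ x → f x ≟ y) (All.lookup y∉ys fx∈ys ∘ sym)))
                       (sum-fibreSizes-∷-∈ xs unique-ys fx∈ys))
            (+-suc _ _)

  length≡sum-fibreSizes : ∀ {ys} → Unique ys → ∀ xs → (∀ {x} → x ∈ xs → f x ∈ ys) →
    length xs ≡ sum (fibreSizes ys xs)
  length≡sum-fibreSizes {ys} _ [] _ = sym (sum-fibreSizes-[] ys)
  length≡sum-fibreSizes unique-ys (x ∷ xs) into = trans
    (cong suc (length≡sum-fibreSizes unique-ys xs (into ∘ there)))
    (sym (sum-fibreSizes-∷-∈ xs unique-ys (into (here refl))))

  sameFibrePairs : List B → List A → List (A × A)
  sameFibrePairs [] xs = []
  sameFibrePairs (y ∷ ys) xs = cartesianProduct (fibre y xs) (fibre y xs) ++ sameFibrePairs ys xs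

  length-sameFibrePairs : ∀ ys xs → length (sameFibrePairs ys xs) ≡ sum (map square (fibreSizes ys xs))
  length-sameFibrePairs [] xs = refl
  length-sameFibrePairs (y ∷ ys) xs = trans
    (length-++ (cartesianProduct (fibre y xs) (fibre y xs)))
    (cong₂ _+_ (length-cartesianProduct (fibre y xs) (fibre y xs)) (length-sameFibrePairs ys xs))

  ∈-sameFibrePairs⁻ : ∀ ys xs {x x′} → (x , x′) ∈ sameFibrePairs ys xs →
    x ∈ xs × x′ ∈ xs × f x ≡ f x′ × f x ∈ ys
  ∈-sameFibrePairs⁻ (y ∷ ys) xs p∈ with ∈-++⁻ (cartesianProduct (fibre y xs) (fibre y xs)) p∈
  ... | inj₂ p∈ys with x∈xs , x′∈xs , fx≡fx′ , fx∈ys ← ∈-sameFibrePairs⁻ ys xs p∈ys =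
    x∈xs , x′∈xs , fx≡fx′ , there fx∈ys
  ... | inj₁ p∈y with x∈fibre , x′∈fibre ← ∈-cartesianProduct⁻ (fibre y xs) (fibre y xs) p∈y
                 with x∈xs , fx≡y ← ∈-filter⁻ (λ x → f x ≟ y) {xs = xs} x∈fibre
                    | x′∈xs , fx′≡y ← ∈-filter⁻ (λ x → f x ≟ y) {xs = xs} x′∈fibre =
    x∈xs , x′∈xs , trans fx≡y (sym fx′≡y) , here fx≡y

  sameFibrePairs⁺ : ∀ {ys xs} → Unique ys → Unique xs → Unique (sameFibrePairs ys xs)
  sameFibrePairs⁺ {[]} _ _ = []
  sameFibrePairs⁺ {y ∷ ys} {xs} (y∉ys ∷ unique-ys) unique-xs =
    ++⁺ (cartesianProduct⁺ unique-fibre unique-fibre) (sameFibrePairs⁺ unique-ys unique-xs) disjoint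
    where
    unique-fibre : Unique (fibre y xs)
    unique-fibre = filter⁺ (λ x → f x ≟ y) unique-xs
    disjoint : ∀ {p} → p ∈ cartesianProduct (fibre y xs) (fibre y xs) × p ∈ sameFibrePairs ys xs → ⊥
    disjoint {x , _} (p∈y , p∈ys)
      with x∈fibre , _ ← ∈-cartesianProduct⁻ (fibre y xs) (fibre y xs) p∈y
         | _ , _ , _ , fx∈ys ← ∈-sameFibrePairs⁻ ys xs p∈ys =
      All.lookup y∉ys fx∈ys (sym (proj₂ (∈-filter⁻ (λ x → f x ≟ y) {xs = xs} x∈fibre)))

m*[m*m]≤m*[n*n]⇒m≤n : ∀ m n → m * (m * m) ≤ m * (n * n) → m ≤ n
m*[m*m]≤m*[n*n]⇒m≤n zero n _ = z≤n
m*[m*m]≤m*[n*n]⇒m≤n m@(suc _) n le =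
  ≮⇒≥ (λ n<m → <⇒≱ (*-monoʳ-< m (*-mono-< n<m n<m)) le)

leftPred rightPred : LVertex → RVertex
leftPred (i , j , k) = (i , i + k)
rightPred (i , j , k) = (i + k + 1 , j)

∈-predSet⁺ : ∀ {L' a v} → a ∈ L' → v ∈ preds a → v ∈ predSet L'
∈-predSet⁺ a∈L' v∈preds = ∈-deduplicate⁺ _≟R_ (∈-concat⁺′ v∈preds (∈-map⁺ preds a∈L'))

leftPred-injectiveOnTree : ∀ {a b} → root a ≡ root b → leftPred a ≡ leftPred b → a ≡ b
leftPred-injectiveOnTree {i , j , _} {_ , _ , _} refl eq
  with refl ← +-cancelˡ-≡ i _ _ (cong proj₂ eq) = refl

rightPred-injectiveOnTree : ∀ {a b} → root a ≡ root b → rightPred a ≡ rightPred b → a ≡ b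
rightPred-injectiveOnTree {i , j , _} {_ , _ , _} refl eq
  with refl ← +-cancelˡ-≡ i _ _ (+-cancelʳ-≡ 1 _ _ (cong proj₁ eq)) = refl

predPair : LVertex × LVertex → RVertex × RVertex
predPair (a , b) = leftPred a , rightPred b

-- The root (i , j) of a tree is read off as the first coordinate of the left predecessor
-- and the second coordinate of the right predecessor.
predPair-injectiveOnSameTree : ∀ {a b c d} → root a ≡ root b → root c ≡ root d →
  predPair (a , b) ≡ predPair (c , d) → (a , b) ≡ (c , d)
predPair-injectiveOnSameTree {_ , _ , _} {_ , _ , _} {_ , _ , _} {_ , _ , _} refl refl eq
  with refl ← cong (proj₁ ∘ proj₁) eq | refl ← cong (proj₂ ∘ proj₂) eq =
  cong₂ _,_ (leftPred-injectiveOnTree refl (cong proj₁ eq)) (rightPred-injectiveOnTree refl (cong proj₂ eq))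

open Fibres _≟R_ root

length-sameFibrePairs≤predSet² : ∀ {ys L'} → Unique ys → Unique L' →
  length (sameFibrePairs ys L') ≤ length (predSet L') * length (predSet L')
length-sameFibrePairs≤predSet² {ys} {L'} unique-ys unique-L' = begin
  length (sameFibrePairs ys L')                          ≤⟨ length-≤-injectiveOn predPair
                                                              (sameFibrePairs⁺ unique-ys unique-L') injective into ⟩
  length (cartesianProduct (predSet L') (predSet L'))    ≡⟨ length-cartesianProduct (predSet L') (predSet L') ⟩
  length (predSet L') * length (predSet L')              ∎
  where
  open ≤-Reasoning
  injective : ∀ {p q} → p ∈ sameFibrePairs ys L' → q ∈ sameFibrePairs ys L' → predPair p ≡ predPair q → p ≡ q
  injective {_ , _} {_ , _} p∈ q∈
    with _ , _ , same-tree-p , _ ← ∈-sameFibrePairs⁻ ys L' p∈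
       | _ , _ , same-tree-q , _ ← ∈-sameFibrePairs⁻ ys L' q∈ =
    predPair-injectiveOnSameTree same-tree-p same-tree-q
  into : ∀ {p} → p ∈ sameFibrePairs ys L' → predPair p ∈ cartesianProduct (predSet L') (predSet L')
  into {_ , _} p∈ with a∈L' , b∈L' , _ ← ∈-sameFibrePairs⁻ ys L' p∈ =
    ∈-cartesianProduct⁺ (∈-predSet⁺ a∈L' (here refl)) (∈-predSet⁺ b∈L' (there (here refl)))

lemma2 : (n M : ℕ) → .{{_ : NonZero M}} → (L' : List LVertex) →
    All (IsLVertex n) L' → Unique L' →
    length L' * length L' ≡ 64 * M ^ 3 →
    length (roots L') ≤ 4 * M →
    length (predSet L') ≥ 4 * M
lemma2 n M L' _ unique-L' |L'|²≡64M³ |roots|≤4M = m*[m*m]≤m*[n*n]⇒m≤n (4 * M) p (begin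
  4 * M * (4 * M * (4 * M))                ≡⟨ cube M ⟩
  64 * M ^ 3                               ≡⟨ |L'|²≡64M³ ⟨
  length L' * length L'                    ≡⟨ cong₂ _*_ |L'|≡Σsizes |L'|≡Σsizes ⟩
  sum sizes * sum sizes                    ≤⟨ sum*sum≤length*sum-squares sizes ⟩
  length sizes * sum (map square sizes)    ≡⟨ cong₂ _*_ (length-map _ K) (sym (length-sameFibrePairs K L')) ⟩
  length K * length (sameFibrePairs K L')  ≤⟨ *-mono-≤ |roots|≤4M (length-sameFibrePairs≤predSet² unique-K unique-L') ⟩
  4 * M * (p * p)                          ∎)
  where
  open ≤-Reasoning
  K : List RVertex
  K = roots L'
  p : ℕ
  p = length (predSet L')
  sizes : List ℕ
  sizes = fibreSizes K L'
  unique-K : Unique K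
  unique-K = deduplicate-! (map root L')
  |L'|≡Σsizes : length L' ≡ sum sizes
  |L'|≡Σsizes = length≡sum-fibreSizes unique-K L' (∈-deduplicate⁺ _≟R_ ∘ ∈-map⁺ root)
  cube : ∀ M → 4 * M * (4 * M * (4 * M)) ≡ 64 * (M * (M * (M * 1)))
  cube = solve-∀
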